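{- There exists a $2$-bounded coloring $f : [\mathbb{N}]^{<\omega} \to \mathbb{N}$ such that there is no infinite set $H \subseteq \mathbb{N}$ with $f$ injective on $[H]^{<\omega}$.
   Context: $[X]^{<\omega}$ is the set of all finite subsets of $X$. A function $f$ is $2$-bounded if every value has at most $2$ preimages. -}

module Defs where

open import Data.Nat using (ℕ; _<_; _≤_)
open import Data.List using (List)
open import Data.List.Relation.Unary.Linked using (Linked)
open import Data.List.Relation.Unary.All using (All)
open import Data.Product using (Σ; ∃; _×_; proj₁)
open import Data.Sum using (_⊎_)
open import Relation.Binary.PropositionalEquality using (_≡_)

-- [ℕ]^{<ω}: a finite subset of ℕ, represented canonically by the
-- strictly increasing list of its elements.
FinSubset : Set
FinSubset = Σ (List ℕ) (Linked _<_)

_≐_ : FinSubset → FinSubset → Set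
a ≐ b = proj₁ a ≡ proj₁ b

SubsetOf : (ℕ → Set) → FinSubset → Set
SubsetOf H s = All H (proj₁ s)

-- f is 2-bounded: every value has at most 2 preimages, i.e. among any
-- three sets with the same colour, two coincide.
TwoBounded : (FinSubset → ℕ) → Set
TwoBounded f = ∀ a b c → f a ≡ f b → f b ≡ f c → (a ≐ b) ⊎ (b ≐ c) ⊎ (a ≐ c)

Infinite : (ℕ → Set) → Set
Infinite H = ∀ n → ∃ λ m → n ≤ m × H m

InjectiveOn : (FinSubset → ℕ) → (ℕ → Set) → Set
InjectiveOn f H = ∀ a b → SubsetOf H a → SubsetOf H b → f a ≡ f b → a ≐ b

{-# OPTIONS --safe #-}
module Submission where

open import Defs
open import Data.Nat using (ℕ; zero; suc; _<_; _≤_; _≟_)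
open import Data.Nat.Properties using (<⇒≢; <⇒≤; <-trans; 1+n≢n)
open import Data.Nat.Binary using (ℕᵇ; zero; 2[1+_]; 1+[2_]; toℕ)
open import Data.Nat.Binary.Properties using (toℕ-injective; 2[1+_]-injective)
open import Data.List using (List; []; _∷_; length)
open import Data.List.Relation.Unary.Linked as Linked using (Linked; []; [-]; _∷_)
open import Data.List.Relation.Unary.Linked.Properties using (Linked⇒AllPairs)
open import Data.List.Relation.Unary.All as All using (All; []; _∷_)
import Data.List.Relation.Unary.AllPairs as AllPairs
open import Data.Product using (Σ; _×_; _,_; proj₁; proj₂)
open import Data.Sum using (_⊎_; inj₁; inj₂)
open import Function using (_∘_)
open import Function.Definitions using (Injective)
open import Relation.Nullary using (¬_; yes; no; contradiction)
open import Relation.Binary.PropositionalEquality using (_≡_; refl; sym; trans; cong; subst)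

-- Idea: colour a finite set s by s itself, except that s is first replaced by
-- s ∖ {min s} when min s = |s| - 1. A colour class then has at most the two
-- members u and {|u|} ∪ u. In an infinite H, take m ∈ H and a set t of m
-- elements of H above m: both {m} ∪ t and t lie in [H]^{<ω} and get colour t.

pigeonhole : ∀ {A : Set} {p q a b c : A} →
             a ≡ p ⊎ a ≡ q → b ≡ p ⊎ b ≡ q → c ≡ p ⊎ c ≡ q →
             a ≡ b ⊎ b ≡ c ⊎ a ≡ c
pigeonhole (inj₁ refl) (inj₁ refl) _           = inj₁ refl
pigeonhole (inj₂ refl) (inj₂ refl) _           = inj₁ refl
pigeonhole _           (inj₁ refl) (inj₁ refl) = inj₂ (inj₁ refl)
pigeonhole _           (inj₂ refl) (inj₂ refl) = inj₂ (inj₁ refl)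
pigeonhole (inj₁ refl) (inj₂ refl) (inj₁ refl) = inj₂ (inj₂ refl)
pigeonhole (inj₂ refl) (inj₁ refl) (inj₂ refl) = inj₂ (inj₂ refl)

-- A list x₁ ∷ … ∷ xₖ is written as the binary word (2[1+_])^{x₁} 1+[2_] … (2[1+_])^{xₖ} 1+[2_] zero,
-- so injectivity reduces to injectivity of the constructors of ℕᵇ.
block : ℕ → ℕᵇ → ℕᵇ
block zero    b = 1+[2 b ]
block (suc x) b = 2[1+ block x b ]

block-injective : ∀ {x y b c} → block x b ≡ block y c → x ≡ y × b ≡ c
block-injective {zero}  {zero}  refl = refl , refl
block-injective {suc x} {suc y} eq with block-injective {x} {y} (2[1+_]-injective eq)
... | refl , b≡c = refl , b≡c

encode : List ℕ → ℕᵇ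
encode []      = zero
encode (x ∷ t) = block x (encode t)

encode-injective : Injective _≡_ _≡_ encode
encode-injective {[]}        {[]}        refl = refl
encode-injective {[]}        {zero ∷ _}  ()
encode-injective {[]}        {suc _ ∷ _} ()
encode-injective {zero ∷ _}  {[]}        ()
encode-injective {suc _ ∷ _} {[]}        ()
encode-injective {x ∷ t}     {y ∷ u}     eq with block-injective {x} {y} eq
... | refl , et≡eu = cong (x ∷_) (encode-injective et≡eu)

code : List ℕ → ℕ
code = toℕ ∘ encode

code-injective : Injective _≡_ _≡_ code
code-injective = encode-injective ∘ toℕ-injective

collapse : List ℕ → List ℕ
collapse []      = []
collapse (x ∷ t) with x ≟ length t
... | yes _ = t
... | no  _ = x ∷ t

collapse-fibre : ∀ {l u} → collapse l ≡ u → l ≡ u ⊎ l ≡ length u ∷ u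
collapse-fibre {[]}    refl = inj₁ refl
collapse-fibre {x ∷ t} eq with x ≟ length t
collapse-fibre {x ∷ t} refl | yes refl = inj₂ refl
collapse-fibre {x ∷ t} eq   | no  _    = inj₁ eq

collapse-drops : ∀ {x t} → x ≡ length t → collapse (x ∷ t) ≡ t
collapse-drops {x} {t} x≡∣t∣ with x ≟ length t
... | yes _     = refl
... | no  x≢∣t∣ = contradiction x≡∣t∣ x≢∣t∣

collapse-fixes : ∀ {l} → All (length l ≤_) l → collapse l ≡ l
collapse-fixes {[]}    []                = refl
collapse-fixes {x ∷ t} (∣t∣<x ∷ _) with x ≟ length t
... | yes x≡∣t∣ = contradiction (sym x≡∣t∣) (<⇒≢ ∣t∣<x)
... | no  _     = refl

colouring : FinSubset → ℕ
colouring = code ∘ collapse ∘ proj₁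

colouring-twoBounded : TwoBounded colouring
colouring-twoBounded (a , _) (b , _) (c , _) fa≡fb fb≡fc =
  pigeonhole (collapse-fibre (code-injective {collapse a} fa≡fb))
             (collapse-fibre refl)
             (collapse-fibre (sym (code-injective {collapse b} fb≡fc)))

module _ {H : ℕ → Set} (H-infinite : Infinite H) where

  next : ℕ → ℕ
  next lo = proj₁ (H-infinite (suc lo))

  chain : ℕ → ℕ → List ℕ
  chain zero    lo = []
  chain (suc k) lo = next lo ∷ chain k (next lo)

  chain-length : ∀ k lo → length (chain k lo) ≡ k
  chain-length zero    lo = refl
  chain-length (suc k) lo = cong suc (chain-length k (next lo))

  chain-increasing : ∀ k lo → Linked _<_ (lo ∷ chain k lo)
  chain-increasing zero    lo = [-]
  chain-increasing (suc k) lo = proj₁ (proj₂ (H-infinite (suc lo))) ∷ chain-increasing k (next lo)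

  chain-⊆ : ∀ k lo → All H (chain k lo)
  chain-⊆ zero    lo = []
  chain-⊆ (suc k) lo = proj₂ (proj₂ (H-infinite (suc lo))) ∷ chain-⊆ k (next lo)

  ¬injectiveOn-colouring : ¬ InjectiveOn colouring H
  ¬injectiveOn-colouring injective =
    1+n≢n (cong length (injective (m ∷ t , chain-increasing m m) (t , Linked.tail (chain-increasing m m))
                                   (Hm ∷ chain-⊆ m m) (chain-⊆ m m) same-colour))
    where
    m : ℕ
    m = proj₁ (H-infinite 0)
    Hm : H m
    Hm = proj₂ (proj₂ (H-infinite 0))
    t : List ℕ
    t = chain m m
    t-above-∣t∣ : All (length t ≤_) t
    t-above-∣t∣ = subst (λ n → All (n ≤_) t) (sym (chain-length m m))
                        (All.map <⇒≤ (AllPairs.head (Linked⇒AllPairs <-trans (chain-increasing m m))))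
    same-colour : code (collapse (m ∷ t)) ≡ code (collapse t)
    same-colour = cong code (trans (collapse-drops (sym (chain-length m m))) (sym (collapse-fixes t-above-∣t∣)))

proposition2p10 : Σ (FinSubset → ℕ) λ f →
    TwoBounded f × ((H : ℕ → Set) → Infinite H → ¬ InjectiveOn f H)
proposition2p10 = colouring , colouring-twoBounded , λ H H-infinite → ¬injectiveOn-colouring H-infinite
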